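{- Let $\mathbf{A}=\langle A,\lor,\land,\to,\neg,\sim,0,1\rangle$ be a Heyting algebra with involution. Then the involutive center $IC(A)=\{a\in A:\neg a=\sim a\}$, with the operations $\lor,\land,\to,\neg,0,1$ of $\mathbf{A}$, i.e. $\langle IC(A),\lor,\land,\to,\neg,0,1\rangle$, is a Boolean algebra.
   Context: A Heyting algebra with involution is an algebra $\langle A,\lor,\land,\to,\neg,\sim,0,1\rangle$ where $\langle A,\lor,\land,\to,\neg,0,1\rangle$ is a Heyting algebra ($a\to b=\sup\{x:a\land x\le b\}$, $\neg a=a\to 0$) and $\sim$ satisfies $\sim(a\lor b)=\sim a\land\sim b$ and $\sim\sim a=a$. -}

module Defs where

open import Level using (Level; _⊔_; suc)
open import Data.Product using (Σ; _,_; proj₁)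
open import Algebra.Core using (Op₁; Op₂)
open import Relation.Binary.Core using (Rel; _Preserves_⟶_)
open import Relation.Binary.Lattice.Bundles using (HeytingAlgebra)
open import Relation.Binary.Lattice.Structures using (IsBooleanAlgebra)

-- Since equality is a setoid
-- equality, ∼ is required to respect it (automatic when _≈_ is _≡_).
record HeytingAlgebraWithInvolution c ℓ₁ ℓ₂ : Set (suc (c ⊔ ℓ₁ ⊔ ℓ₂)) where
  field
    heytingAlgebra : HeytingAlgebra c ℓ₁ ℓ₂
  open HeytingAlgebra heytingAlgebra public
  infix 8 ∼_ ¬_
  field
    ∼_     : Op₁ Carrier
    ∼-cong : ∼_ Preserves _≈_ ⟶ _≈_
    ∼-∨    : ∀ a b → ∼ (a ∨ b) ≈ (∼ a ∧ ∼ b)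
    ∼-∼    : ∀ a → ∼ ∼ a ≈ a

  ¬_ : Op₁ Carrier
  ¬ a = a ⇨ ⊥

  IC : Carrier → Set ℓ₁
  IC a = ¬ a ≈ ∼ a

  ICCarrier : Set (c ⊔ ℓ₁)
  ICCarrier = Σ Carrier IC

  _≈ᵢ_ : Rel ICCarrier ℓ₁
  x ≈ᵢ y = proj₁ x ≈ proj₁ y

  _≤ᵢ_ : Rel ICCarrier ℓ₂
  x ≤ᵢ y = proj₁ x ≤ proj₁ y

record ICClosed {c ℓ₁ ℓ₂} (H : HeytingAlgebraWithInvolution c ℓ₁ ℓ₂)
       : Set (c ⊔ ℓ₁) where
  open HeytingAlgebraWithInvolution H
  field
    ∨-closed : ∀ {a b} → IC a → IC b → IC (a ∨ b)
    ∧-closed : ∀ {a b} → IC a → IC b → IC (a ∧ b)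
    ⇨-closed : ∀ {a b} → IC a → IC b → IC (a ⇨ b)
    ¬-closed : ∀ {a} → IC a → IC (¬ a)
    ⊥-closed : IC ⊥
    ⊤-closed : IC ⊤

module ICOps {c ℓ₁ ℓ₂} (H : HeytingAlgebraWithInvolution c ℓ₁ ℓ₂)
             (cl : ICClosed H) where
  open HeytingAlgebraWithInvolution H
  open ICClosed cl

  _∨ᵢ_ : Op₂ ICCarrier
  (a , p) ∨ᵢ (b , q) = (a ∨ b) , ∨-closed p q

  _∧ᵢ_ : Op₂ ICCarrier
  (a , p) ∧ᵢ (b , q) = (a ∧ b) , ∧-closed p q

  _⇨ᵢ_ : Op₂ ICCarrier
  (a , p) ⇨ᵢ (b , q) = (a ⇨ b) , ⇨-closed p q

  ¬ᵢ_ : Op₁ ICCarrier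
  ¬ᵢ (a , p) = (¬ a) , ¬-closed p

  ⊥ᵢ : ICCarrier
  ⊥ᵢ = ⊥ , ⊥-closed

  ⊤ᵢ : ICCarrier
  ⊤ᵢ = ⊤ , ⊤-closed

-- ⟨IC(A), ∨, ∧, →, ¬, 0, 1⟩ is a Boolean algebra: the restricted
-- ∨, ∧, ¬, 1, 0 form a Boolean algebra (stdlib order-theoretic notion:
-- a bounded lattice in which x ↦ ¬ x ∨ y is the Heyting exponential), and
-- the restricted → is its implication, i.e. x → y = ¬ x ∨ y.
record ICBoolean {c ℓ₁ ℓ₂} (H : HeytingAlgebraWithInvolution c ℓ₁ ℓ₂)
       (cl : ICClosed H) : Set (c ⊔ ℓ₁ ⊔ ℓ₂) where
  open HeytingAlgebraWithInvolution H
  open ICOps H cl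
  field
    isBooleanAlgebra : IsBooleanAlgebra _≈ᵢ_ _≤ᵢ_ _∨ᵢ_ _∧ᵢ_ ¬ᵢ_ ⊤ᵢ ⊥ᵢ
    ⇨-is-implication : ∀ x y → (x ⇨ᵢ y) ≈ᵢ ((¬ᵢ x) ∨ᵢ y)

-- In any Heyting algebra an element a with ⊤ ≤ a ∨ ¬ a behaves classically:
-- ¬ a is its unique complement, ¬ ¬ a ≈ a, a ⇨ b ≈ ¬ a ∨ b and
-- ¬ (a ∧ b) ≈ ¬ a ∨ ¬ b.  For a in IC(A) the involution turns
-- non-contradiction into excluded middle: ∼ (a ∨ ∼ a) ≈ ∼ a ∧ a ≈ ¬ a ∧ a ≤ ⊥,
-- so a ∨ ¬ a ≈ ∼ ∼ (a ∨ ∼ a) ≥ ∼ ⊥ ≈ ⊤.  Closure of IC(A) under the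
-- operations then reduces to these classical identities together with the
-- De Morgan laws for ∼, and the Boolean structure is inherited from A.
module Submission where

open import Defs
open import Data.Product using (Σ; _,_; proj₁)
open import Relation.Binary.Lattice.Bundles using (HeytingAlgebra)
import Relation.Binary.Construct.On as On
import Relation.Binary.Lattice.Properties.HeytingAlgebra as HeytingProperties
import Relation.Binary.Lattice.Properties.JoinSemilattice as JoinProperties
import Relation.Binary.Lattice.Properties.MeetSemilattice as MeetProperties
import Relation.Binary.Reasoning.PartialOrder as ≤-Reasoning

module ComplementedElements {c ℓ₁ ℓ₂} (L : HeytingAlgebra c ℓ₁ ℓ₂) where
  open HeytingAlgebra L
  open HeytingProperties L
    using (¬_; ⇨-eval; ⇨-curry; y≤x⇨y; ⇨ʳ-covariant; swap-transpose-⇨; ∧-distribˡ-∨)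
  open ≤-Reasoning poset

  Complemented : Carrier → Set ℓ₂
  Complemented a = ⊤ ≤ a ∨ ¬ a

  cover⇒⇨≤∨ : ∀ {a b d} → ⊤ ≤ a ∨ d → a ⇨ b ≤ d ∨ b
  cover⇒⇨≤∨ {a} {b} {d} ⊤≤a∨d = begin
    a ⇨ b                           ≤⟨ ∧-greatest refl (trans (maximum _) ⊤≤a∨d) ⟩
    (a ⇨ b) ∧ (a ∨ d)               ≈⟨ ∧-distribˡ-∨ _ _ _ ⟩
    ((a ⇨ b) ∧ a) ∨ ((a ⇨ b) ∧ d)   ≤⟨ ∨-least (trans ⇨-eval (y≤x∨y _ _))
                                               (trans (x∧y≤y _ _) (x≤x∨y _ _)) ⟩
    d ∨ b                           ∎

  complement⇒¬≈ : ∀ {a d} → a ∧ d ≤ ⊥ → ⊤ ≤ a ∨ d → ¬ a ≈ d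
  complement⇒¬≈ a∧d≤⊥ ⊤≤a∨d = antisym
    (trans (cover⇒⇨≤∨ ⊤≤a∨d) (∨-least refl (minimum _)))
    (swap-transpose-⇨ a∧d≤⊥)

  complemented⇒¬¬≈ : ∀ {a} → Complemented a → ¬ ¬ a ≈ a
  complemented⇒¬¬≈ {a} ⊤≤a∨¬a =
    complement⇒¬≈ ⇨-eval (trans ⊤≤a∨¬a (∨-least (y≤x∨y _ _) (x≤x∨y _ _)))

  complemented⇒⇨≈¬∨ : ∀ {a b} → Complemented a → a ⇨ b ≈ ¬ a ∨ b
  complemented⇒⇨≈¬∨ ⊤≤a∨¬a =
    antisym (cover⇒⇨≤∨ ⊤≤a∨¬a) (∨-least (⇨ʳ-covariant (minimum _)) y≤x⇨y)

  complemented⇒¬∧≈¬∨¬ : ∀ {a b} → Complemented a → ¬ (a ∧ b) ≈ ¬ a ∨ ¬ b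
  complemented⇒¬∧≈¬∨¬ ⊤≤a∨¬a = Eq.trans ⇨-curry (complemented⇒⇨≈¬∨ ⊤≤a∨¬a)

module InvolutiveCenter {c ℓ₁ ℓ₂} (H : HeytingAlgebraWithInvolution c ℓ₁ ℓ₂) where
  open HeytingAlgebraWithInvolution H
  open HeytingProperties heytingAlgebra
    using (⇨-eval; ⇨-unit; ⇨-cong; de-morgan₁)
  open JoinProperties joinSemilattice using (∨-cong; x≤y⇒x∨y≈y)
  open MeetProperties meetSemilattice using (∧-cong)
  open ComplementedElements heytingAlgebra
  open ≤-Reasoning poset

  ∼-antitone : ∀ {a b} → a ≤ b → ∼ b ≤ ∼ a
  ∼-antitone {a} {b} a≤b = begin
    ∼ b         ≈⟨ ∼-cong (Eq.sym (x≤y⇒x∨y≈y a≤b)) ⟩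
    ∼ (a ∨ b)   ≈⟨ ∼-∨ a b ⟩
    ∼ a ∧ ∼ b   ≤⟨ x∧y≤x _ _ ⟩
    ∼ a         ∎

  ∼-⊥ : ∼ ⊥ ≈ ⊤
  ∼-⊥ = antisym (maximum _) (trans (reflexive (Eq.sym (∼-∼ ⊤))) (∼-antitone (minimum _)))

  ∼-∧ : ∀ a b → ∼ (a ∧ b) ≈ ∼ a ∨ ∼ b
  ∼-∧ a b = begin-equality
    ∼ (a ∧ b)           ≈⟨ ∼-cong (∧-cong (Eq.sym (∼-∼ a)) (Eq.sym (∼-∼ b))) ⟩
    ∼ (∼ ∼ a ∧ ∼ ∼ b)   ≈⟨ ∼-cong (Eq.sym (∼-∨ (∼ a) (∼ b))) ⟩
    ∼ ∼ (∼ a ∨ ∼ b)     ≈⟨ ∼-∼ _ ⟩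
    ∼ a ∨ ∼ b           ∎

  IC-resp : ∀ {a b} → a ≈ b → IC b → IC a
  IC-resp a≈b ¬b≈∼b = Eq.trans (⇨-cong a≈b Eq.refl) (Eq.trans ¬b≈∼b (∼-cong (Eq.sym a≈b)))

  IC⇒complemented : ∀ {a} → IC a → Complemented a
  IC⇒complemented {a} ¬a≈∼a = begin
    ⊤                 ≈⟨ Eq.sym ∼-⊥ ⟩
    ∼ ⊥               ≤⟨ ∼-antitone ∼[a∨∼a]≤⊥ ⟩
    ∼ ∼ (a ∨ ∼ a)     ≈⟨ ∼-∼ _ ⟩
    a ∨ ∼ a           ≈⟨ ∨-cong Eq.refl (Eq.sym ¬a≈∼a) ⟩
    a ∨ ¬ a           ∎
    where
    ∼[a∨∼a]≤⊥ : ∼ (a ∨ ∼ a) ≤ ⊥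
    ∼[a∨∼a]≤⊥ = begin
      ∼ (a ∨ ∼ a)     ≈⟨ ∼-∨ _ _ ⟩
      ∼ a ∧ ∼ ∼ a     ≈⟨ ∧-cong (Eq.sym ¬a≈∼a) (∼-∼ a) ⟩
      ¬ a ∧ a         ≤⟨ ⇨-eval ⟩
      ⊥               ∎

  IC-∨ : ∀ {a b} → IC a → IC b → IC (a ∨ b)
  IC-∨ {a} {b} ¬a≈∼a ¬b≈∼b =
    Eq.trans (de-morgan₁ a b) (Eq.trans (∧-cong ¬a≈∼a ¬b≈∼b) (Eq.sym (∼-∨ a b)))

  IC-∧ : ∀ {a b} → IC a → IC b → IC (a ∧ b)
  IC-∧ {a} {b} ¬a≈∼a ¬b≈∼b = Eq.trans (complemented⇒¬∧≈¬∨¬ (IC⇒complemented ¬a≈∼a))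
    (Eq.trans (∨-cong ¬a≈∼a ¬b≈∼b) (Eq.sym (∼-∧ a b)))

  IC-¬ : ∀ {a} → IC a → IC (¬ a)
  IC-¬ {a} ¬a≈∼a = begin-equality
    ¬ ¬ a     ≈⟨ complemented⇒¬¬≈ (IC⇒complemented ¬a≈∼a) ⟩
    a         ≈⟨ Eq.sym (∼-∼ a) ⟩
    ∼ ∼ a     ≈⟨ ∼-cong (Eq.sym ¬a≈∼a) ⟩
    ∼ ¬ a     ∎

  IC-⇨ : ∀ {a b} → IC a → IC b → IC (a ⇨ b)
  IC-⇨ ¬a≈∼a ¬b≈∼b = IC-resp (complemented⇒⇨≈¬∨ (IC⇒complemented ¬a≈∼a))
                             (IC-∨ (IC-¬ ¬a≈∼a) ¬b≈∼b)

  IC-⊥ : IC ⊥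
  IC-⊥ = Eq.trans ⇨-unit (Eq.sym ∼-⊥)

  IC-⊤ : IC ⊤
  IC-⊤ = IC-resp (Eq.sym ⇨-unit) (IC-¬ IC-⊥)

  IC-closed : ICClosed H
  IC-closed = record
    { ∨-closed = IC-∨ ; ∧-closed = IC-∧ ; ⇨-closed = IC-⇨
    ; ¬-closed = IC-¬ ; ⊥-closed = IC-⊥ ; ⊤-closed = IC-⊤ }

  open ICOps H IC-closed

  ⇨ᵢ≈¬ᵢ∨ᵢ : ∀ x y → (x ⇨ᵢ y) ≈ᵢ ((¬ᵢ x) ∨ᵢ y)
  ⇨ᵢ≈¬ᵢ∨ᵢ (a , ¬a≈∼a) _ = complemented⇒⇨≈¬∨ (IC⇒complemented ¬a≈∼a)

  IC-boolean : ICBoolean H IC-closed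
  IC-boolean = record
    { isBooleanAlgebra = record
      { isHeytingAlgebra = record
        { isBoundedLattice = record
          { isLattice = record
            { isPartialOrder = On.isPartialOrder proj₁ isPartialOrder
            ; supremum = λ _ _ → x≤x∨y _ _ , y≤x∨y _ _ , λ _ → ∨-least
            ; infimum  = λ _ _ → x∧y≤x _ _ , x∧y≤y _ _ , λ _ → ∧-greatest
            }
          ; maximum = λ _ → maximum _
          ; minimum = λ _ → minimum _
          }
        ; exponential = λ w x y →
            (λ w∧x≤y → trans (transpose-⇨ w∧x≤y) (reflexive (⇨ᵢ≈¬ᵢ∨ᵢ x y)))
          , (λ w≤¬x∨y → transpose-∧ (trans w≤¬x∨y (reflexive (Eq.sym (⇨ᵢ≈¬ᵢ∨ᵢ x y)))))
        }
      }
    ; ⇨-is-implication = ⇨ᵢ≈¬ᵢ∨ᵢ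
    }

lemma3p3 : ∀ {c ℓ₁ ℓ₂} (H : HeytingAlgebraWithInvolution c ℓ₁ ℓ₂) →
    Σ (ICClosed H) (λ cl → ICBoolean H cl)
lemma3p3 H = IC-closed , IC-boolean
  where open InvolutiveCenter H
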